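{- Let $L$ be a set of labels equipped with a symmetric relation $\sim$ ("matches"). For words $u=u_1\cdots u_n$ and $v=v_1\cdots v_n$ over $L$ of the same length, write $u\sim v$ if $u_i\sim v_{n+1-i}$ for all $i=1,\dots,n$. In particular, for words $x_1,x_2,y_1,y_2$ with $|x_1|=|y_2|$ and $|x_2|=|y_1|$, one has $x_1x_2\sim y_1y_2$ if and only if $x_1\sim y_2$ and $x_2\sim y_1$. Let $s\ge 1$ and let $a^{(s-1)},b^{(s-1)},\dots,p^{(s-1)}$ be sixteen words over $L$ (one for each letter $a,b,\dots,p$). Define sixteen words $a^{(s)},\dots,p^{(s)}$ by concatenation: \begin{align*} &a^{(s)}=p^{(s-1)}a^{(s-1)},\ b^{(s)}=b^{(s-1)}k^{(s-1)},\ c^{(s)}=l^{(s-1)}m^{(s-1)},\ d^{(s)}=n^{(s-1)}o^{(s-1)},\\ &e^{(s)}=d^{(s-1)}e^{(s-1)},\ f^{(s)}=f^{(s-1)}g^{(s-1)},\ g^{(s)}=l^{(s-1)}m^{(s-1)},\ h^{(s)}=n^{(s-1)}o^{(s-1)},\\ &i^{(s)}=h^{(s-1)}i^{(s-1)},\ j^{(s)}=j^{(s-1)}c^{(s-1)},\ k^{(s)}=d^{(s-1)}e^{(s-1)},\ l^{(s)}=f^{(s-1)}g^{(s-1)},\\ &m^{(s)}=l^{(s-1)}m^{(s-1)},\ n^{(s)}=n^{(s-1)}o^{(s-1)},\ o^{(s)}=d^{(s-1)}e^{(s-1)},\ p^{(s)}=f^{(s-1)}g^{(s-1)}. \end{align*}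 Suppose that $a^{(s-1)}=c^{(s-1)}=g^{(s-1)}=m^{(s-1)}$, $f^{(s-1)}=j^{(s-1)}=l^{(s-1)}=p^{(s-1)}$, and $a^{(s-1)}\sim f^{(s-1)}$; and that $e^{(s-1)}=i^{(s-1)}=k^{(s-1)}=o^{(s-1)}$, $b^{(s-1)}=d^{(s-1)}=h^{(s-1)}=n^{(s-1)}$, and $e^{(s-1)}\sim b^{(s-1)}$. Then $a^{(s)}=c^{(s)}=g^{(s)}=m^{(s)}$, $f^{(s)}=j^{(s)}=l^{(s)}=p^{(s)}$, and $a^{(s)}\sim f^{(s)}$; and $e^{(s)}=i^{(s)}=k^{(s)}=o^{(s)}$, $b^{(s)}=d^{(s)}=h^{(s)}=n^{(s)}$, and $e^{(s)}\sim b^{(s)}$.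
   Context: This concerns edge-labelled tiles in the "(5,10)" L-tiling by two prototiles $\alpha,\beta$, whose sixteen edges are labelled $a,\dots,p$. The notation $\frac{x_1=\cdots=x_r}{y_1=\cdots=y_t}$ means that all $x_i$ are equal, all $y_j$ are equal, and each $x_i$ matches (is glued to) each $y_j$. An edge of an $s$-spread is the concatenation of edges of the $(s-1)$-spread, and two concatenated edges match when their constituent pieces match in reversed order (a shared edge is traversed in opposite directions by the two tiles). Equality of words is letter-by-letter equality. -}

module Defs where

open import Data.List using (List; _++_; reverse; length)
open import Data.List.Relation.Binary.Pointwise using (Pointwise)
open import Data.Product using (_×_)
open import Relation.Binary.PropositionalEquality using (_≡_)

data Letter : Set where
  a b c d e f g h i j k l m n o p : Letter

WMatch : {L : Set} → (L → L → Set) → List L → List L → Set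
WMatch _∼_ u v = (length u ≡ length v) × Pointwise _∼_ u (reverse v)

step : {L : Set} → (Letter → List L) → (Letter → List L)
step w a = w p ++ w a
step w b = w b ++ w k
step w c = w l ++ w m
step w d = w n ++ w o
step w e = w d ++ w e
step w f = w f ++ w g
step w g = w l ++ w m
step w h = w n ++ w o
step w i = w h ++ w i
step w j = w j ++ w c
step w k = w d ++ w e
step w l = w f ++ w g
step w m = w l ++ w m
step w n = w n ++ w o
step w o = w d ++ w e
step w p = w f ++ w g

Inv : {L : Set} → (L → L → Set) → (Letter → List L) → Set
Inv _∼_ w =
  ((w a ≡ w c) × (w a ≡ w g) × (w a ≡ w m)) ×
  ((w f ≡ w j) × (w f ≡ w l) × (w f ≡ w p)) ×
  WMatch _∼_ (w a) (w f) ×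
  ((w e ≡ w i) × (w e ≡ w k) × (w e ≡ w o)) ×
  ((w b ≡ w d) × (w b ≡ w h) × (w b ≡ w n)) ×
  WMatch _∼_ (w e) (w b)

-- After one step every word of the class {a,c,g,m,f,j,l,p} becomes f⁽ˢ⁻¹⁾a⁽ˢ⁻¹⁾ and every
-- word of the class {e,i,k,o,b,d,h,n} becomes b⁽ˢ⁻¹⁾e⁽ˢ⁻¹⁾. The required matchings are then
-- self-matchings of words y x with x ∼ y, which follow from the splitting rule for ∼ on
-- concatenations together with the symmetry of ∼.
module Submission where

open import Defs
open import Data.Nat using (ℕ; suc; _≤_; _∸_)
open import Data.List using (List; []; _∷_; _++_; length; reverse)
open import Data.List.Properties using (length-reverse; reverse-++; reverse-involutive)
open import Data.List.Relation.Binary.Pointwise as Pointwise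
  using (Pointwise; []; _∷_; Pointwise-length)
open import Data.Nat.Properties using (suc-injective)
open import Data.Product using (_×_; _,_)
open import Function.Bundles using (_⇔_; mk⇔; Equivalence)
open import Relation.Binary.PropositionalEquality
  using (_≡_; refl; sym; trans; subst)
open import Relation.Binary.Definitions using (Symmetric)

Pointwise-++⁻ : {A B : Set} {R : A → B → Set} (x₁ : List A) {x₂ : List A}
  (y₁ : List B) {y₂ : List B} → length x₁ ≡ length y₁ →
  Pointwise R (x₁ ++ x₂) (y₁ ++ y₂) → Pointwise R x₁ y₁ × Pointwise R x₂ y₂
Pointwise-++⁻ []       []       _         rs       = [] , rs
Pointwise-++⁻ (_ ∷ x₁) (_ ∷ y₁) |x₁|≡|y₁| (r ∷ rs)
  with Pointwise-++⁻ x₁ y₁ (suc-injective |x₁|≡|y₁|) rs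
... | rs₁ , rs₂ = r ∷ rs₁ , rs₂

module _ {L : Set} {_∼_ : L → L → Set} where

  WMatch-fromPointwise : {u : List L} (v : List L) → Pointwise _∼_ u (reverse v) →
    WMatch _∼_ u v
  WMatch-fromPointwise v rs = trans (Pointwise-length rs) (length-reverse v) , rs

  WMatch-sym : Symmetric _∼_ → {u v : List L} → WMatch _∼_ u v → WMatch _∼_ v u
  WMatch-sym ∼-sym {u} {v} (_ , rs) = WMatch-fromPointwise u
    (subst (λ z → Pointwise _∼_ z (reverse u)) (reverse-involutive v)
      (Pointwise.reverse⁺ (Pointwise.symmetric ∼-sym rs)))

  WMatch-++⇔ : (x₁ x₂ y₁ y₂ : List L) → length x₁ ≡ length y₂ → length x₂ ≡ length y₁ →
    WMatch _∼_ (x₁ ++ x₂) (y₁ ++ y₂) ⇔ (WMatch _∼_ x₁ y₂ × WMatch _∼_ x₂ y₁)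
  WMatch-++⇔ x₁ x₂ y₁ y₂ |x₁|≡|y₂| |x₂|≡|y₁| = mk⇔ split join
    where
    split : WMatch _∼_ (x₁ ++ x₂) (y₁ ++ y₂) → WMatch _∼_ x₁ y₂ × WMatch _∼_ x₂ y₁
    split (_ , rs) with Pointwise-++⁻ x₁ (reverse y₂)
                          (trans |x₁|≡|y₂| (sym (length-reverse y₂)))
                          (subst (Pointwise _∼_ (x₁ ++ x₂)) (reverse-++ y₁ y₂) rs)
    ... | rs₁ , rs₂ = (|x₁|≡|y₂| , rs₁) , (|x₂|≡|y₁| , rs₂)

    join : WMatch _∼_ x₁ y₂ × WMatch _∼_ x₂ y₁ → WMatch _∼_ (x₁ ++ x₂) (y₁ ++ y₂)
    join ((_ , rs₁) , (_ , rs₂)) = WMatch-fromPointwise (y₁ ++ y₂)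
      (subst (Pointwise _∼_ (x₁ ++ x₂)) (sym (reverse-++ y₁ y₂)) (Pointwise.++⁺ rs₁ rs₂))

  WMatch-++-self : Symmetric _∼_ → {x y : List L} → WMatch _∼_ x y →
    WMatch _∼_ (y ++ x) (y ++ x)
  WMatch-++-self ∼-sym {x} {y} x∼y@(|x|≡|y| , _) =
    Equivalence.from (WMatch-++⇔ y x y x (sym |x|≡|y|) |x|≡|y|) (WMatch-sym ∼-sym x∼y , x∼y)

  Inv-step : Symmetric _∼_ → (w : Letter → List L) → Inv _∼_ w → Inv _∼_ (step w)
  Inv-step ∼-sym w ((ac , ag , am) , (fj , fl , fp) , a∼f , (ei , ek , eo) , (bd , bh , bn) , e∼b)
    rewrite sym ac | sym ag | sym am | sym fj | sym fl | sym fp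
          | sym ei | sym ek | sym eo | sym bd | sym bh | sym bn
    = (refl , refl , refl) , (refl , refl , refl) , WMatch-++-self ∼-sym a∼f
    , (refl , refl , refl) , (refl , refl , refl) , WMatch-++-self ∼-sym e∼b

mainTheorem1 : {L : Set} (_∼_ : L → L → Set) → Symmetric _∼_ →
    ((x₁ x₂ y₁ y₂ : List L) → length x₁ ≡ length y₂ → length x₂ ≡ length y₁ →
      WMatch _∼_ (x₁ ++ x₂) (y₁ ++ y₂) ⇔ (WMatch _∼_ x₁ y₂ × WMatch _∼_ x₂ y₁))
    ×
    ((s : ℕ) → 1 ≤ s → (spread : ℕ → Letter → List L) →
      ((t : ℕ) → spread (suc t) ≡ step (spread t)) →
      Inv _∼_ (spread (s ∸ 1)) → Inv _∼_ (spread s))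
mainTheorem1 {L} _∼_ ∼-sym = WMatch-++⇔ , spread-Inv
  where
  spread-Inv : (s : ℕ) → 1 ≤ s → (spread : ℕ → Letter → List L) →
    ((t : ℕ) → spread (suc t) ≡ step (spread t)) →
    Inv _∼_ (spread (s ∸ 1)) → Inv _∼_ (spread s)
  spread-Inv (suc t) _ spread spread-step inv rewrite spread-step t = Inv-step ∼-sym (spread t) inv
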